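{- The following are equivalent: (i) For every finite set $X$ and every intersection-closed $S\subseteq\mathcal{P}(X)$ with $|S|>1$, there is some $p\in X$ that is an element of at most half of the sets in $S$. (ii) For every $n\geq 1$ and every extended submonoid $M\subseteq\mathbb{F}_2^n$, there exists a pseudocomplement $M\to M$.
   Context: A family $S$ of sets is intersection-closed if $A\cap B\in S$ for all $A,B\in S$. For a commutative ring $R$, $R^{\mathrm{Aut}(R)}$ is the subring fixed by all ring automorphisms. An extended submonoid of $R$ is a multiplicatively closed subset $M\subseteq R$ with $1\in M$ and $R^{\mathrm{Aut}(R)}\subseteq M$. For an extended submonoid $M\subseteq\mathbb{F}_2^n$ and an involution $T:M\to M$ (i.e. $T\circ T=\mathrm{id}_M$), the quadratic ideal of $T$ is the ideal $\Lambda(T)$ of $\mathbb{F}_2^n$ generated by $\{xT(x):x\in M\}$; $T$ is a pseudocomplement if $\Lambda(T)$ is a proper ideal. -}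

module Defs where

open import Data.Nat using (ℕ; _*_; _≤_; _<_; _≥_)
open import Data.Bool using (Bool; true; false; _xor_; _∧_)
open import Data.Vec using (Vec; zipWith; replicate)
open import Data.Fin using (Fin)
open import Data.Fin.Subset using (Subset; _∩_)
open import Data.Fin.Subset.Properties using (_∈?_)
open import Data.List using (List; length; filter)
open import Data.List.Relation.Unary.Unique.Propositional using (Unique)
import Data.List.Membership.Propositional as LM
open import Data.Product using (Σ; ∃; _×_)
open import Relation.Binary.PropositionalEquality using (_≡_)
open import Relation.Nullary using (¬_)

-- Statement (i): intersection-closed families.
-- A finite set X is (up to bijection) Fin m; a family S ⊆ P(X) is a
-- duplicate-free list of subsets of Fin m.

IntersectionClosed : ∀ {m} → List (Subset m) → Set
IntersectionClosed S = ∀ A B → A LM.∈ S → B LM.∈ S → (A ∩ B) LM.∈ S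

occurrences : ∀ {m} → Fin m → List (Subset m) → ℕ
occurrences p S = length (filter (p ∈?_) S)

StatementI : Set
StatementI =
  ∀ (m : ℕ) (S : List (Subset m)) → Unique S → IntersectionClosed S →
  1 < length S → ∃ λ (p : Fin m) → 2 * occurrences p S ≤ length S

F2^ : ℕ → Set
F2^ n = Vec Bool n

_+ᶠ_ : ∀ {n} → F2^ n → F2^ n → F2^ n
_+ᶠ_ = zipWith _xor_

_·ᶠ_ : ∀ {n} → F2^ n → F2^ n → F2^ n
_·ᶠ_ = zipWith _∧_

0ᶠ : ∀ {n} → F2^ n
0ᶠ = replicate _ false

1ᶠ : ∀ {n} → F2^ n
1ᶠ = replicate _ true

IsRingAut : ∀ {n} → (F2^ n → F2^ n) → Set
IsRingAut {n} φ =
  (∀ x y → φ (x +ᶠ y) ≡ φ x +ᶠ φ y) ×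
  (∀ x y → φ (x ·ᶠ y) ≡ φ x ·ᶠ φ y) ×
  (φ 1ᶠ ≡ 1ᶠ) ×
  Σ (F2^ n → F2^ n) (λ ψ → (∀ x → ψ (φ x) ≡ x) × (∀ x → φ (ψ x) ≡ x))

InFixedRing : ∀ {n} → F2^ n → Set
InFixedRing {n} x = ∀ (φ : F2^ n → F2^ n) → IsRingAut φ → φ x ≡ x

_∈ᴹ_ : ∀ {n} → F2^ n → (F2^ n → Bool) → Set
x ∈ᴹ M = M x ≡ true

IsExtendedSubmonoid : ∀ {n} → (F2^ n → Bool) → Set
IsExtendedSubmonoid {n} M =
  (1ᶠ ∈ᴹ M) ×
  (∀ x y → x ∈ᴹ M → y ∈ᴹ M → (x ·ᶠ y) ∈ᴹ M) ×
  (∀ x → InFixedRing x → x ∈ᴹ M)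

-- a map M → M, represented by a function on F₂ⁿ whose values off M are
-- irrelevant, which is an involution on M
IsInvolutionOn : ∀ {n} → (F2^ n → Bool) → (F2^ n → F2^ n) → Set
IsInvolutionOn M T = (∀ x → x ∈ᴹ M → T x ∈ᴹ M) × (∀ x → x ∈ᴹ M → T (T x) ≡ x)

data InIdealGen {n} (G : F2^ n → Set) : F2^ n → Set where
  ig-zero : InIdealGen G 0ᶠ
  ig-gen  : ∀ {g} → G g → InIdealGen G g
  ig-add  : ∀ {a b} → InIdealGen G a → InIdealGen G b → InIdealGen G (a +ᶠ b)
  ig-mul  : ∀ r {a} → InIdealGen G a → InIdealGen G (r ·ᶠ a)

-- generators of the quadratic ideal Λ(T): the elements x·T(x), x ∈ M
QuadGen : ∀ {n} → (F2^ n → Bool) → (F2^ n → F2^ n) → F2^ n → Set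
QuadGen {n} M T z = Σ (F2^ n) (λ x → x ∈ᴹ M × z ≡ x ·ᶠ T x)

-- Λ(T) is proper iff 1 ∉ Λ(T)
IsPseudocomplement : ∀ {n} → (F2^ n → Bool) → (F2^ n → F2^ n) → Set
IsPseudocomplement M T = IsInvolutionOn M T × ¬ InIdealGen (QuadGen M T) 1ᶠ

StatementII : Set
StatementII =
  ∀ (n : ℕ) → n ≥ 1 → (M : F2^ n → Bool) → IsExtendedSubmonoid M →
  Σ (F2^ n → F2^ n) (λ T → IsPseudocomplement M T)

module Submission where

-- We read 𝔽₂ⁿ as Subset n: multiplication is ∩, 1 is 1ᶠ = ⊤, 0 is 0ᶠ = ⊥.
-- The proof rests on two bridges, both stated for a coordinate p and a
-- duplicate-free list L of the elements of a set M ⊆ 𝔽₂ⁿ: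
--   * counting: at most half of L contains p  iff  some involution T of L
--     moves every element containing p to one not containing p
--     ('involution-count', 'separating-involution');
--   * ideals: such a T makes Λ(T) avoid coordinate p, hence proper, and
--     conversely a proper Λ(T) has a coordinate at which all its generators
--     x·T(x) vanish ('leaves⇒proper', 'proper⇒leaves').
-- Together with the fact that the fixed ring of 𝔽₂ⁿ is {0, 1} (coordinate
-- transpositions are automorphisms), (i) ⇒ (ii) applies (i) to the elements
-- of M.  For (ii) ⇒ (i), an intersection-closed family S is turned into a
-- submonoid of 𝔽₂ⁿ containing 0 by collapsing the coordinates of its least
-- member K onto a coordinate outside K, adjoining 1 if it is missing.

open import Defs
open import Function.Base using (_∘_)
open import Function.Bundles using (_⇔_; mk⇔; Equivalence)
open import Data.Nat using (zero; suc; _+_; _*_; _≤_; _<_; z≤n; s≤s)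
open import Data.Nat.Properties
  using (+-suc; +-identityʳ; +-monoʳ-≤; +-cancelˡ-≤; *-suc; ≤-pred; <⇒≤; module ≤-Reasoning)
open import Data.Nat.Base using (>-nonZero⁻¹)
open import Data.Bool using (Bool; true; false; _xor_; _∧_; _∨_)
open import Data.Bool.Properties using (¬-not) renaming (_≟_ to _≟ᵇ_)
open import Data.Vec using (Vec; []; _∷_; lookup; zipWith; replicate; tabulate)
import Data.Vec as Vec
open import Data.Vec.Properties
  using (lookup-zipWith; lookup-replicate; lookup∘tabulate; tabulate∘lookup;
         tabulate-cong; zipWith-replicate; ∷-injectiveʳ; []=⇒lookup; lookup⇒[]=; ≡-dec)
open import Data.Fin using (Fin; zero; suc)
open import Data.Fin.Properties using (¬∀⟶∃¬; all?; nonZeroIndex) renaming (_≟_ to _≟ᶠ_)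
open import Data.Fin.Permutation.Components using (transpose; transpose-inverse)
open import Data.Fin.Subset using (Subset; _∩_; _∪_; ⋂; ⋃)
  renaming (_∈_ to _∈ₛ_; _∉_ to _∉ₛ_; _⊆_ to _⊆ₛ_)
open import Data.Fin.Subset.Properties
  using (_∈?_; ∉⊥; ∈⊤; ⊆⊤; ⊆-antisym; ⊆-trans; p∩q⊆p; p∩q⊆q; x∈p∩q⁺; x∈p∩q⁻; x∈p∪q⁺;
         ∩-identityˡ; ∩-identityʳ)
open import Data.List using (List; []; _∷_; length; map; _++_; filter)
open import Data.List.Properties using (length-++; length-map; filter-accept)
open import Data.List.Relation.Unary.All as All using (All; []; _∷_)
open import Data.List.Relation.Unary.All.Properties
  using (All¬⇒¬Any; ¬Any⇒All¬; all-filter) renaming (map⁺ to All-map⁺; map⁻ to All-map⁻)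
open import Data.List.Relation.Unary.Any as Any using (Any; here; there)
open import Data.List.Relation.Unary.Unique.Propositional using (Unique; []; _∷_)
open import Data.List.Relation.Unary.Unique.Propositional.Properties
  using (++⁺) renaming (map⁺ to Unique-map⁺; filter⁺ to Unique-filter⁺)
open import Data.List.Membership.Propositional using (_∈_; _∉_)
open import Data.List.Membership.Propositional.Properties
  using (∈-∃++; ∈-++⁻; ∈-++⁺ˡ; ∈-++⁺ʳ; ∈-map⁺; ∈-map⁻; ∈-filter⁺; ∈-filter⁻)
import Data.List.Membership.DecPropositional as DecMembership
open import Data.Product using (Σ; ∃; _×_; _,_; proj₁; proj₂)
open import Data.Sum using (_⊎_; inj₁; inj₂)
open import Relation.Nullary using (¬_; Dec; yes; no; does; contradiction)
open import Relation.Nullary.Decidable using (dec-true)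
open import Relation.Unary using (Decidable; ∁)
open import Relation.Unary.Properties using (∁?)
open import Relation.Binary.Definitions using (DecidableEquality)
open import Relation.Binary.PropositionalEquality
  using (_≡_; _≢_; refl; sym; trans; cong; cong₂; subst; subst₂; module ≡-Reasoning)

unique-⊆-length : ∀ {A : Set} {xs ys : List A} → Unique xs →
                  (∀ {x} → x ∈ xs → x ∈ ys) → length xs ≤ length ys
unique-⊆-length {xs = []} _ _ = z≤n
unique-⊆-length {xs = x ∷ xs} (x∉xs ∷ xs!) xs⊆ys with ∈-∃++ (xs⊆ys (here refl))
... | us , vs , refl = begin
  suc (length xs)             ≤⟨ s≤s (unique-⊆-length xs! xs⊆us++vs) ⟩
  suc (length (us ++ vs))     ≡⟨ cong suc (length-++ us) ⟩
  suc (length us + length vs) ≡⟨ +-suc (length us) (length vs) ⟨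
  length us + suc (length vs) ≡⟨ length-++ us ⟨
  length (us ++ x ∷ vs)       ∎
  where
  open ≤-Reasoning
  -- x is removed from ys, but x does not occur in xs
  xs⊆us++vs : ∀ {y} → y ∈ xs → y ∈ us ++ vs
  xs⊆us++vs y∈xs with ∈-++⁻ us (xs⊆ys (there y∈xs))
  ... | inj₁ y∈us         = ∈-++⁺ˡ y∈us
  ... | inj₂ (here refl)  = contradiction refl (All.lookup x∉xs y∈xs)
  ... | inj₂ (there y∈vs) = ∈-++⁺ʳ us y∈vs

map-unique : ∀ {A B : Set} (f : A → B) {xs : List A} → Unique xs →
             (∀ {x y} → x ∈ xs → y ∈ xs → f x ≡ f y → x ≡ y) → Unique (map f xs)
map-unique f {[]} [] _ = []
map-unique f {x ∷ xs} (x∉xs ∷ xs!) f-inj =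
  All-map⁺ (All.tabulate fx≢fy) ∷ map-unique f xs! (λ x∈ y∈ → f-inj (there x∈) (there y∈))
  where
  fx≢fy : ∀ {y} → y ∈ xs → f x ≢ f y
  fx≢fy y∈xs = All.lookup x∉xs y∈xs ∘ f-inj (here refl) (there y∈xs)

length-filter-map : ∀ {A B : Set} {P : B → Set} {Q : A → Set}
                    (P? : Decidable P) (Q? : Decidable Q) (f : A → B) →
                    (∀ x → P (f x) ⇔ Q x) →
                    ∀ xs → length (filter P? (map f xs)) ≡ length (filter Q? xs)
length-filter-map P? Q? f P∘f⇔Q [] = refl
length-filter-map P? Q? f P∘f⇔Q (x ∷ xs) with P? (f x) | Q? x
... | yes _   | yes _  = cong suc (length-filter-map P? Q? f P∘f⇔Q xs)
... | no _    | no _   = length-filter-map P? Q? f P∘f⇔Q xs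
... | yes Pfx | no ¬Qx = contradiction (Equivalence.to (P∘f⇔Q x) Pfx) ¬Qx
... | no ¬Pfx | yes Qx = contradiction (Equivalence.from (P∘f⇔Q x) Qx) ¬Pfx

module _ {A : Set} {P : A → Set} (P? : Decidable P) where

  length-filter-∁ : ∀ xs → length (filter P? xs) + length (filter (∁? P?) xs) ≡ length xs
  length-filter-∁ [] = refl
  length-filter-∁ (x ∷ xs) with P? x
  ... | yes _ = cong suc (length-filter-∁ xs)
  ... | no _  = trans (+-suc _ _) (cong suc (length-filter-∁ xs))

  -- If an involution T of a duplicate-free list L moves every element of L
  -- satisfying P to one that does not, at most half of L satisfies P:
  -- T maps the P-part injectively into the non-P-part.
  involution-count : ∀ (T : A → A) {L} → Unique L → (∀ {x} → x ∈ L → T x ∈ L) →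
                     (∀ {x} → x ∈ L → T (T x) ≡ x) → (∀ {x} → x ∈ L → P x → ¬ P (T x)) →
                     2 * length (filter P? L) ≤ length L
  involution-count T {L} L! T∈L T-involutive T-leaves = begin
    2 * length inside              ≡⟨ cong (length inside +_) (+-identityʳ (length inside)) ⟩
    length inside + length inside  ≤⟨ +-monoʳ-≤ (length inside) inside≤outside ⟩
    length inside + length outside ≡⟨ length-filter-∁ L ⟩
    length L                       ∎
    where
    open ≤-Reasoning
    inside outside : List A
    inside  = filter P? L
    outside = filter (∁? P?) L

    T-injective : ∀ {x y} → x ∈ inside → y ∈ inside → T x ≡ T y → x ≡ y
    T-injective x∈ y∈ Tx≡Ty = trans (sym (T-involutive (proj₁ (∈-filter⁻ P? x∈))))
                                (trans (cong T Tx≡Ty) (T-involutive (proj₁ (∈-filter⁻ P? y∈))))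

    T[inside]⊆outside : ∀ {z} → z ∈ map T inside → z ∈ outside
    T[inside]⊆outside z∈ with ∈-map⁻ T z∈
    ... | x , x∈ , refl with ∈-filter⁻ P? x∈
    ...   | x∈L , Px = ∈-filter⁺ (∁? P?) (T∈L x∈L) (T-leaves x∈L Px)

    inside≤outside : length inside ≤ length outside
    inside≤outside = begin
      length inside         ≡⟨ length-map T inside ⟨
      length (map T inside) ≤⟨ unique-⊆-length (map-unique T (Unique-filter⁺ P? L!) T-injective)
                                                T[inside]⊆outside ⟩
      length outside        ∎

-- The involution for the converse direction swaps two lists elementwise.

module Swap {A : Set} (_≟_ : DecidableEquality A) where

  swap : List A → List A → A → A
  swap (a ∷ as) (b ∷ bs) x with x ≟ a | x ≟ b
  ... | yes _ | _     = b
  ... | no _  | yes _ = a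
  ... | no _  | no _  = swap as bs x
  swap _ _ x = x

  swap-first : ∀ {a b} as bs → swap (a ∷ as) (b ∷ bs) a ≡ b
  swap-first {a} as bs with a ≟ a
  ... | yes _   = refl
  ... | no a≢a  = contradiction refl a≢a

  swap-second : ∀ {a b} as bs → a ≢ b → swap (a ∷ as) (b ∷ bs) b ≡ a
  swap-second {a} {b} as bs a≢b with b ≟ a | b ≟ b
  ... | yes b≡a | _      = contradiction (sym b≡a) a≢b
  ... | no _    | yes _  = refl
  ... | no _    | no b≢b = contradiction refl b≢b

  swap-rest : ∀ {a b x} as bs → x ≢ a → x ≢ b → swap (a ∷ as) (b ∷ bs) x ≡ swap as bs x
  swap-rest {a} {b} {x} as bs x≢a x≢b with x ≟ a | x ≟ b
  ... | yes x≡a | _       = contradiction x≡a x≢a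
  ... | no _    | yes x≡b = contradiction x≡b x≢b
  ... | no _    | no _    = refl

  swap-fixes : ∀ as bs {x} → x ∉ as → x ∉ bs → swap as bs x ≡ x
  swap-fixes [] bs _ _ = refl
  swap-fixes (a ∷ as) [] _ _ = refl
  swap-fixes (a ∷ as) (b ∷ bs) {x} x∉as x∉bs with x ≟ a | x ≟ b
  ... | yes x≡a | _       = contradiction (here x≡a) x∉as
  ... | no _    | yes x≡b = contradiction (here x≡b) x∉bs
  ... | no _    | no _    = swap-fixes as bs (x∉as ∘ there) (x∉bs ∘ there)

  swap-preserves : ∀ {Q : A → Set} as bs → All Q as → All Q bs → ∀ {x} → Q x → Q (swap as bs x)
  swap-preserves [] bs _ _ Qx = Qx
  swap-preserves (a ∷ as) [] _ _ Qx = Qx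
  swap-preserves (a ∷ as) (b ∷ bs) (Qa ∷ Qas) (Qb ∷ Qbs) {x} Qx with x ≟ a | x ≟ b
  ... | yes _ | _     = Qb
  ... | no _  | yes _ = Qa
  ... | no _  | no _  = swap-preserves as bs Qas Qbs Qx

  module _ {P : A → Set} where

    swap-into : ∀ as bs → length as ≤ length bs → All P as → All (∁ P) bs →
                ∀ {x} → x ∈ as → swap as bs x ∈ bs
    swap-into (a ∷ as) (b ∷ bs) _ _ _ (here refl) = subst (_∈ b ∷ bs) (sym (swap-first as bs)) (here refl)
    swap-into (a ∷ as) (b ∷ bs) (s≤s len) (Pa ∷ Pas) (¬Pb ∷ ¬Pbs) {x} (there x∈as) with x ≟ a | x ≟ b
    ... | yes _ | _        = here refl
    ... | no _  | yes refl = contradiction (All.lookup Pas x∈as) ¬Pb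
    ... | no _  | no _     = there (swap-into as bs len Pas ¬Pbs x∈as)

    swap-involutive : ∀ as bs → Unique as → Unique bs → All P as → All (∁ P) bs →
                      ∀ x → swap as bs (swap as bs x) ≡ x
    swap-involutive [] bs _ _ _ _ x = refl
    swap-involutive (a ∷ as) [] _ _ _ _ x = refl
    swap-involutive (a ∷ as) (b ∷ bs) (a∉as ∷ as!) (b∉bs ∷ bs!) (Pa ∷ Pas) (¬Pb ∷ ¬Pbs) x
      with x ≟ a | x ≟ b
    ... | yes refl | _        = swap-second as bs a≢b
      where
      a≢b : a ≢ b
      a≢b refl = ¬Pb Pa
    ... | no _     | yes refl = swap-first as bs
    ... | no x≢a   | no x≢b   = begin
      swap (a ∷ as) (b ∷ bs) y ≡⟨ swap-rest as bs y≢a y≢b ⟩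
      swap as bs y             ≡⟨ tail-involutive ⟩
      x                        ∎
      where
      open ≡-Reasoning
      y : A
      y = swap as bs x
      tail-involutive : swap as bs y ≡ x
      tail-involutive = swap-involutive as bs as! bs! Pas ¬Pbs x
      -- a and b occur in neither tail, so the tail swap fixes them
      y≢a : y ≢ a
      y≢a y≡a = x≢a (begin
        x            ≡⟨ tail-involutive ⟨
        swap as bs y ≡⟨ cong (swap as bs) y≡a ⟩
        swap as bs a ≡⟨ swap-fixes as bs (All¬⇒¬Any a∉as) (λ a∈bs → All.lookup ¬Pbs a∈bs Pa) ⟩
        a            ∎)
      y≢b : y ≢ b
      y≢b y≡b = x≢b (begin
        x            ≡⟨ tail-involutive ⟨
        swap as bs y ≡⟨ cong (swap as bs) y≡b ⟩
        swap as bs b ≡⟨ swap-fixes as bs (λ b∈as → ¬Pb (All.lookup Pas b∈as)) (All¬⇒¬Any b∉bs) ⟩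
        b            ∎)

separating-involution : ∀ {A : Set} → DecidableEquality A →
  ∀ {P : A → Set} (P? : Decidable P) {L} → Unique L → 2 * length (filter P? L) ≤ length L →
  Σ (A → A) λ T → (∀ {x} → x ∈ L → T x ∈ L) × (∀ x → T (T x) ≡ x) ×
                  (∀ {x} → x ∈ L → P x → ¬ P (T x))
separating-involution {A} _≟_ {P} P? {L} L! half =
  swap inside outside , T∈L ,
  swap-involutive inside outside inside! outside! (all-filter P? L) (all-filter (∁? P?) L) ,
  T-leaves
  where
  open Swap _≟_
  inside outside : List A
  inside  = filter P? L
  outside = filter (∁? P?) L
  inside! : Unique inside
  inside! = Unique-filter⁺ P? L!
  outside! : Unique outside
  outside! = Unique-filter⁺ (∁? P?) L!

  inside≤outside : length inside ≤ length outside
  inside≤outside = +-cancelˡ-≤ (length inside) _ _ (begin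
    length inside + length inside  ≡⟨ cong (length inside +_) (+-identityʳ (length inside)) ⟨
    2 * length inside              ≤⟨ half ⟩
    length L                       ≡⟨ length-filter-∁ P? L ⟨
    length inside + length outside ∎)
    where open ≤-Reasoning

  T∈L : ∀ {x} → x ∈ L → swap inside outside x ∈ L
  T∈L = swap-preserves inside outside (All.tabulate (proj₁ ∘ ∈-filter⁻ P?))
                                      (All.tabulate (proj₁ ∘ ∈-filter⁻ (∁? P?)))

  T-leaves : ∀ {x} → x ∈ L → P x → ¬ P (swap inside outside x)
  T-leaves x∈L Px = proj₂ (∈-filter⁻ (∁? P?) {xs = L} (swap-into inside outside inside≤outside
                      (all-filter P? L) (all-filter (∁? P?) L) (∈-filter⁺ P? x∈L Px)))

_≟ₛ_ : ∀ {n} → DecidableEquality (Subset n)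
_≟ₛ_ = ≡-dec _≟ᵇ_

_∈ˡ?_ : ∀ {n} (x : Subset n) (L : List (Subset n)) → Dec (x ∈ L)
x ∈ˡ? L = DecMembership._∈?_ _≟ₛ_ x L

lookup-ext : ∀ {A : Set} {n} {x y : Vec A n} → (∀ i → lookup x i ≡ lookup y i) → x ≡ y
lookup-ext {x = x} {y} same = trans (sym (tabulate∘lookup x)) (trans (tabulate-cong same) (tabulate∘lookup y))

∉-+ᶠ : ∀ {n} {i : Fin n} {x y : Subset n} → i ∉ₛ x → i ∉ₛ y → i ∉ₛ x +ᶠ y
∉-+ᶠ {i = zero}  {true ∷ x}  {_}        i∉x _   _         = i∉x Vec.here
∉-+ᶠ {i = zero}  {false ∷ x} {true ∷ y} _   i∉y _         = i∉y Vec.here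
∉-+ᶠ {i = suc i} {_ ∷ x}     {_ ∷ y}    i∉x i∉y (Vec.there i∈) =
  ∉-+ᶠ (i∉x ∘ Vec.there) (i∉y ∘ Vec.there) i∈

∪-as-ring : ∀ {n} (x y : Subset n) → x ∪ y ≡ (x +ᶠ y) +ᶠ (x ∩ y)
∪-as-ring [] [] = refl
∪-as-ring (a ∷ x) (b ∷ y) = cong₂ _∷_ (bit a b) (∪-as-ring x y)
  where
  bit : ∀ a b → a ∨ b ≡ (a xor b) xor (a ∧ b)
  bit true  true  = refl
  bit true  false = refl
  bit false true  = refl
  bit false false = refl

preimage : ∀ {m n} → (Fin m → Fin n) → Subset n → Subset m
preimage h x = tabulate (λ j → lookup x (h j))

module _ {m n} (h : Fin m → Fin n) where

  lookup-preimage : ∀ x j → lookup (preimage h x) j ≡ lookup x (h j)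
  lookup-preimage x j = lookup∘tabulate (λ j → lookup x (h j)) j

  ∈-preimage : ∀ {x j} → j ∈ₛ preimage h x ⇔ h j ∈ₛ x
  ∈-preimage {x} {j} = mk⇔
    (λ j∈ → lookup⇒[]= (h j) x (trans (sym (lookup-preimage x j)) ([]=⇒lookup j∈)))
    (λ hj∈ → lookup⇒[]= j (preimage h x) (trans (lookup-preimage x j) ([]=⇒lookup hj∈)))

  preimage-zipWith : ∀ (f : Bool → Bool → Bool) x y →
                     preimage h (zipWith f x y) ≡ zipWith f (preimage h x) (preimage h y)
  preimage-zipWith f x y = lookup-ext λ j → begin
    lookup (preimage h (zipWith f x y)) j                ≡⟨ lookup-preimage (zipWith f x y) j ⟩
    lookup (zipWith f x y) (h j)                         ≡⟨ lookup-zipWith f (h j) x y ⟩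
    f (lookup x (h j)) (lookup y (h j))                  ≡⟨ cong₂ f (lookup-preimage x j) (lookup-preimage y j) ⟨
    f (lookup (preimage h x) j) (lookup (preimage h y) j) ≡⟨ lookup-zipWith f j (preimage h x) (preimage h y) ⟨
    lookup (zipWith f (preimage h x) (preimage h y)) j   ∎
    where open ≡-Reasoning

  preimage-replicate : ∀ b → preimage h (replicate n b) ≡ replicate m b
  preimage-replicate b = lookup-ext λ j →
    trans (lookup-preimage (replicate n b) j) (trans (lookup-replicate (h j) b) (sym (lookup-replicate j b)))

preimage-inverse : ∀ {n} {σ τ : Fin n → Fin n} → (∀ k → σ (τ k) ≡ k) →
                   ∀ x → preimage τ (preimage σ x) ≡ x
preimage-inverse {σ = σ} {τ} στ x = lookup-ext λ j →
  trans (lookup-preimage τ (preimage σ x) j) (trans (lookup-preimage σ x (τ j)) (cong (lookup x) (στ j)))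

permutation-aut : ∀ {n} (σ τ : Fin n → Fin n) → (∀ k → σ (τ k) ≡ k) → (∀ k → τ (σ k) ≡ k) →
                  IsRingAut (preimage σ)
permutation-aut σ τ στ τσ =
  preimage-zipWith σ _xor_ , preimage-zipWith σ _∧_ , preimage-replicate σ true ,
  preimage τ , preimage-inverse στ , preimage-inverse τσ

-- Every automorphism fixes 0 = 1 + 1.
fixed-0 : ∀ {n} → InFixedRing {n} 0ᶠ
fixed-0 φ (φ-+ , _ , φ-1 , _) = begin
  φ 0ᶠ          ≡⟨ cong φ (sym 1+1≡0) ⟩
  φ (1ᶠ +ᶠ 1ᶠ)   ≡⟨ φ-+ 1ᶠ 1ᶠ ⟩
  φ 1ᶠ +ᶠ φ 1ᶠ   ≡⟨ cong₂ _+ᶠ_ φ-1 φ-1 ⟩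
  1ᶠ +ᶠ 1ᶠ       ≡⟨ 1+1≡0 ⟩
  0ᶠ            ∎
  where
  open ≡-Reasoning
  1+1≡0 : 1ᶠ +ᶠ 1ᶠ ≡ 0ᶠ
  1+1≡0 = zipWith-replicate _xor_ true true

-- An element fixed by all automorphisms is 0 or 1: if x had a coordinate i
-- set and a coordinate j unset, the transposition of i and j would move x.
fixed⇒0or1 : ∀ {n} {x : Subset n} → InFixedRing x → x ≡ 0ᶠ ⊎ x ≡ 1ᶠ
fixed⇒0or1 {n} {x} x-fixed with all? (λ i → lookup x i ≟ᵇ false) | all? (λ i → lookup x i ≟ᵇ true)
... | yes all-unset | _ = inj₁ (lookup-ext λ i → trans (all-unset i) (sym (lookup-replicate i false)))
... | no _ | yes all-set = inj₂ (lookup-ext λ i → trans (all-set i) (sym (lookup-replicate i true)))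
... | no ¬all-unset | no ¬all-set
  with ¬∀⟶∃¬ n _ (λ i → lookup x i ≟ᵇ false) ¬all-unset | ¬∀⟶∃¬ n _ (λ i → lookup x i ≟ᵇ true) ¬all-set
... | i , xᵢ≢false | j , xⱼ≢true = contradiction (trans (sym (¬-not xᵢ≢false)) xᵢ≡xⱼ) (xⱼ≢true ∘ sym)
  where
  open ≡-Reasoning
  τ : Fin n → Fin n
  τ = transpose i j
  τ-moves-i : τ i ≡ j
  τ-moves-i with i ≟ᶠ i
  ... | yes _  = refl
  ... | no i≢i = contradiction refl i≢i
  xᵢ≡xⱼ : lookup x i ≡ lookup x j
  xᵢ≡xⱼ = begin
    lookup x i               ≡⟨ cong (λ v → lookup v i)
                                  (x-fixed (preimage τ) (permutation-aut τ (transpose j i) (λ _ → transpose-inverse i j)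
                                                                   (λ _ → transpose-inverse j i))) ⟨
    lookup (preimage τ x) i  ≡⟨ lookup-preimage τ x i ⟩
    lookup x (τ i)           ≡⟨ cong (lookup x) τ-moves-i ⟩
    lookup x j               ∎

∈-⋃ : ∀ {n} {i : Fin n} {zs} → Any (i ∈ₛ_) zs → i ∈ₛ ⋃ zs
∈-⋃ (here i∈z)   = x∈p∪q⁺ (inj₁ i∈z)
∈-⋃ (there i∈zs) = x∈p∪q⁺ (inj₂ (∈-⋃ i∈zs))

module _ {n} {G : Subset n → Set} where

  ideal-avoids : ∀ {i} → (∀ {g} → G g → i ∉ₛ g) → ∀ {z} → InIdealGen G z → i ∉ₛ z
  ideal-avoids G∌i ig-zero          = ∉⊥
  ideal-avoids G∌i (ig-gen Gg)      = G∌i Gg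
  ideal-avoids G∌i (ig-add a∈ b∈)   = ∉-+ᶠ (ideal-avoids G∌i a∈) (ideal-avoids G∌i b∈)
  ideal-avoids G∌i (ig-mul r {a} a∈) = ideal-avoids G∌i a∈ ∘ p∩q⊆q r a

  ideal-⋃ : ∀ {zs} → All (InIdealGen G) zs → InIdealGen G (⋃ zs)
  ideal-⋃ [] = ig-zero
  ideal-⋃ {z ∷ zs} (z∈ ∷ zs∈) =
    subst (InIdealGen G) (sym (∪-as-ring z (⋃ zs))) (ig-add (ig-add z∈ rest∈) (ig-mul z rest∈))
    where
    rest∈ : InIdealGen G (⋃ zs)
    rest∈ = ideal-⋃ zs∈

  -- Finitely many elements of a proper ideal have a common zero coordinate;
  -- otherwise their union would be 1.
  proper⇒common-zero : ∀ zs → All (InIdealGen G) zs → ¬ InIdealGen G 1ᶠ → ∃ λ i → All (i ∉ₛ_) zs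
  proper⇒common-zero zs zs∈ proper with all? (λ i → Any.any? (i ∈?_) zs)
  ... | yes covered = contradiction (subst (InIdealGen G) ⋃zs≡1 (ideal-⋃ zs∈)) proper
    where
    ⋃zs≡1 : ⋃ zs ≡ 1ᶠ
    ⋃zs≡1 = ⊆-antisym ⊆⊤ (λ {i} _ → ∈-⋃ (covered i))
  ... | no ¬covered with ¬∀⟶∃¬ n _ (λ i → Any.any? (i ∈?_) zs) ¬covered
  ...   | i , uncovered = i , ¬Any⇒All¬ zs uncovered

_Lists_ : ∀ {n} → List (Subset n) → (Subset n → Bool) → Set
L Lists M = ∀ x → x ∈ L ⇔ x ∈ᴹ M

module _ {n} (M : Subset n → Bool) (T : Subset n → Subset n) where

  Leaves : Fin n → Set
  Leaves p = ∀ {x} → x ∈ᴹ M → p ∈ₛ x → p ∉ₛ T x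

  leaves⇒proper : ∀ p → Leaves p → ¬ InIdealGen (QuadGen M T) 1ᶠ
  leaves⇒proper p leaves 1∈Λ = ideal-avoids generators-avoid 1∈Λ ∈⊤
    where
    generators-avoid : ∀ {g} → QuadGen M T g → p ∉ₛ g
    generators-avoid (x , x∈M , refl) p∈xTx with x∈p∩q⁻ x (T x) p∈xTx
    ... | p∈x , p∈Tx = leaves x∈M p∈x p∈Tx

  proper⇒leaves : ∀ L → L Lists M → ¬ InIdealGen (QuadGen M T) 1ᶠ → ∃ Leaves
  proper⇒leaves L L-lists proper with proper⇒common-zero (map (λ x → x ∩ T x) L) generators proper
    where
    generators : All (InIdealGen (QuadGen M T)) (map (λ x → x ∩ T x) L)
    generators = All-map⁺ (All.tabulate λ {x} x∈L → ig-gen (x , Equivalence.to (L-lists x) x∈L , refl))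
  ... | p , avoided = p , λ {x} x∈M p∈x p∈Tx →
    All.lookup (All-map⁻ avoided) (Equivalence.from (L-lists x) x∈M) (x∈p∩q⁺ (p∈x , p∈Tx))

subsets : ∀ n → List (Subset n)
subsets zero    = [] ∷ []
subsets (suc n) = map (true ∷_) (subsets n) ++ map (false ∷_) (subsets n)

∈-subsets : ∀ {n} (x : Subset n) → x ∈ subsets n
∈-subsets []          = here refl
∈-subsets (true ∷ x)  = ∈-++⁺ˡ (∈-map⁺ (true ∷_) (∈-subsets x))
∈-subsets (false ∷ x) = ∈-++⁺ʳ _ (∈-map⁺ (false ∷_) (∈-subsets x))

subsets-unique : ∀ n → Unique (subsets n)
subsets-unique zero    = [] ∷ []
subsets-unique (suc n) =
  ++⁺ (Unique-map⁺ ∷-injectiveʳ (subsets-unique n)) (Unique-map⁺ ∷-injectiveʳ (subsets-unique n)) disjoint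
  where
  disjoint : ∀ {v} → ¬ (v ∈ map (true ∷_) (subsets n) × v ∈ map (false ∷_) (subsets n))
  disjoint (v∈ , v∈′) with ∈-map⁻ (true ∷_) v∈ | ∈-map⁻ (false ∷_) v∈′
  ... | _ , _ , refl | _ , _ , ()

distinct-members : ∀ {A : Set} {x y : A} {xs : List A} → x ∈ xs → y ∈ xs → x ≢ y → 1 < length xs
distinct-members {xs = _ ∷ []}    (here refl) (here refl) x≢y = contradiction refl x≢y
distinct-members {xs = _ ∷ _ ∷ _} _           _           _   = s≤s (s≤s z≤n)

elements : ∀ {n} → (Subset n → Bool) → List (Subset n)
elements M = filter (λ x → M x ≟ᵇ true) (subsets _)

elements-lists : ∀ {n} (M : Subset n → Bool) → elements M Lists M
elements-lists M x = mk⇔ (proj₂ ∘ ∈-filter⁻ (λ x → M x ≟ᵇ true) {xs = subsets _})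
                         (∈-filter⁺ (λ x → M x ≟ᵇ true) (∈-subsets x))

elements-unique : ∀ {n} (M : Subset n → Bool) → Unique (elements M)
elements-unique M = Unique-filter⁺ (λ x → M x ≟ᵇ true) (subsets-unique _)

-- Apply (i) to the elements of M to find a rare coordinate p; an involution
-- moving the elements containing p off p is a pseudocomplement.
I⇒II : StatementI → StatementII
I⇒II statementI (suc k) _ M (1∈M , M-closed , fixed⊆M) =
  let (p , p-rare) = statementI (suc k) L (elements-unique M) L-closed L-large
      (T , T∈L , T-involutive , T-leaves) = separating-involution _≟ₛ_ (p ∈?_) (elements-unique M) p-rare
  in T , ((λ x → to ∘ T∈L ∘ from) , (λ x _ → T-involutive x)) , leaves⇒proper M T p (T-leaves ∘ from)
  where
  L : List (Subset (suc k))
  L = elements M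
  to : ∀ {x} → x ∈ L → x ∈ᴹ M
  to {x} = Equivalence.to (elements-lists M x)
  from : ∀ {x} → x ∈ᴹ M → x ∈ L
  from {x} = Equivalence.from (elements-lists M x)
  L-closed : IntersectionClosed L
  L-closed x y x∈L y∈L = from (M-closed x y (to x∈L) (to y∈L))
  L-large : 1 < length L
  L-large = distinct-members (from (fixed⊆M 0ᶠ fixed-0)) (from 1∈M) (λ ())

member : ∀ {n} → List (Subset n) → Subset n → Bool
member L x = does (x ∈ˡ? L)

member-lists : ∀ {n} (L : List (Subset n)) → L Lists member L
member-lists L x = mk⇔ (dec-true (x ∈ˡ? L)) from
  where
  from : x ∈ᴹ member L → x ∈ L
  from x∈M with x ∈ˡ? L
  ... | yes x∈L = x∈L

II⇒I-submonoid : StatementII → ∀ {n} → 1 ≤ n → (L : List (Subset n)) → Unique L →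
                 IntersectionClosed L → 0ᶠ ∈ L → 1ᶠ ∈ L → ∃ λ p → 2 * occurrences p L ≤ length L
II⇒I-submonoid statementII {n} n≥1 L L-unique L-closed 0∈L 1∈L =
  let (T , (T-maps , T-involutive) , Λ-proper) = statementII n n≥1 (member L) L-extended
      (p , leaves) = proper⇒leaves (member L) T L (member-lists L) Λ-proper
  in p , involution-count (p ∈?_) T L-unique (λ x∈L → from (T-maps _ (to x∈L)))
                          (λ x∈L → T-involutive _ (to x∈L)) (λ x∈L → leaves (to x∈L))
  where
  to : ∀ {x} → x ∈ L → x ∈ᴹ member L
  to {x} = Equivalence.to (member-lists L x)
  from : ∀ {x} → x ∈ᴹ member L → x ∈ L
  from {x} = Equivalence.from (member-lists L x)
  0or1∈L : ∀ {x} → x ≡ 0ᶠ ⊎ x ≡ 1ᶠ → x ∈ L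
  0or1∈L (inj₁ refl) = 0∈L
  0or1∈L (inj₂ refl) = 1∈L
  L-extended : IsExtendedSubmonoid (member L)
  L-extended = to 1∈L , (λ x y x∈M y∈M → to (L-closed x y (from x∈M) (from y∈M))) ,
               (λ x x-fixed → to (0or1∈L (fixed⇒0or1 x-fixed)))

adjoin-1-closed : ∀ {n} {L : List (Subset n)} → IntersectionClosed L → IntersectionClosed (1ᶠ ∷ L)
adjoin-1-closed {L = L} L-closed x y (here refl) y∈ = subst (_∈ 1ᶠ ∷ L) (sym (∩-identityˡ y)) y∈
adjoin-1-closed {L = L} L-closed x y (there x∈L) (here refl) =
  subst (_∈ 1ᶠ ∷ L) (sym (∩-identityʳ x)) (there x∈L)
adjoin-1-closed L-closed x y (there x∈L) (there y∈L) = there (L-closed x y x∈L y∈L)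

halve-step : ∀ a b → 2 * suc a ≤ suc b → 2 * a ≤ b
halve-step a b 2[1+a]≤1+b = <⇒≤ (≤-pred (subst (_≤ suc b) (*-suc 2 a) 2[1+a]≤1+b))

-- The same without assuming 1 ∈ L: adjoining 1 adds one member, which
-- contains every coordinate.
II⇒I-with-zero : StatementII → ∀ {n} → 1 ≤ n → (L : List (Subset n)) → Unique L →
                 IntersectionClosed L → 0ᶠ ∈ L → ∃ λ p → 2 * occurrences p L ≤ length L
II⇒I-with-zero statementII n≥1 L L-unique L-closed 0∈L with 1ᶠ ∈ˡ? L
... | yes 1∈L = II⇒I-submonoid statementII n≥1 L L-unique L-closed 0∈L 1∈L
... | no 1∉L with II⇒I-submonoid statementII n≥1 (1ᶠ ∷ L) (¬Any⇒All¬ L 1∉L ∷ L-unique)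
                                  (adjoin-1-closed L-closed) (there 0∈L) (here refl)
...   | p , bound = p , halve-step (occurrences p L) (length L)
                         (subst (λ o → 2 * o ≤ suc (length L)) occurrences-1∷L bound)
  where
  occurrences-1∷L : occurrences p (1ᶠ ∷ L) ≡ suc (occurrences p L)
  occurrences-1∷L = cong length (filter-accept (p ∈?_) ∈⊤)

-- Collapsing the coordinates of K onto a coordinate q outside K: the map
-- collapse = squash⁻¹ preserves ∩, sends K to 0 and is injective on the
-- supersets of K, while its coordinate p counts coordinate squash p.
module Collapse {m} (K : Subset m) (q : Fin m) (q∉K : q ∉ₛ K) where

  squash : Fin m → Fin m
  squash j with j ∈? K
  ... | yes _ = q
  ... | no _  = j

  collapse : Subset m → Subset m
  collapse = preimage squash

  collapse-∩ : ∀ x y → collapse (x ∩ y) ≡ collapse x ∩ collapse y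
  collapse-∩ = preimage-zipWith squash _∧_

  collapse-K : collapse K ≡ 0ᶠ
  collapse-K = lookup-ext λ j →
    trans (lookup-preimage squash K j) (trans (unset j) (sym (lookup-replicate j false)))
    where
    lookup-outside : ∀ {i} → i ∉ₛ K → lookup K i ≡ false
    lookup-outside i∉K = ¬-not (i∉K ∘ lookup⇒[]= _ K)
    unset : ∀ j → lookup K (squash j) ≡ false
    unset j with j ∈? K
    ... | yes _  = lookup-outside q∉K
    ... | no j∉K = lookup-outside j∉K

  collapse-injective : ∀ {x y} → K ⊆ₛ x → K ⊆ₛ y → collapse x ≡ collapse y → x ≡ y
  collapse-injective {x} {y} K⊆x K⊆y same = lookup-ext agree
    where
    agree : ∀ j → lookup x j ≡ lookup y j
    agree j with j ∈? K | lookup-preimage squash x j | lookup-preimage squash y j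
    ... | yes j∈K | _   | _   = trans ([]=⇒lookup (K⊆x j∈K)) (sym ([]=⇒lookup (K⊆y j∈K)))
    ... | no _    | x-j | y-j = trans (sym x-j) (trans (cong (λ v → lookup v j) same) y-j)

  occurrences-collapse : ∀ p S → occurrences p (map collapse S) ≡ occurrences (squash p) S
  occurrences-collapse p = length-filter-map (p ∈?_) (squash p ∈?_) collapse (λ _ → ∈-preimage squash)

  II⇒I-collapsed : StatementII → (S : List (Subset m)) → Unique S → IntersectionClosed S →
                   K ∈ S → (∀ {A} → A ∈ S → K ⊆ₛ A) → ∃ λ p → 2 * occurrences p S ≤ length S
  II⇒I-collapsed statementII S S-unique S-closed K∈S K-least =
    let (p , bound) = II⇒I-with-zero statementII (>-nonZero⁻¹ m {{nonZeroIndex q}}) L L-unique L-closed 0∈L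
    in squash p , subst₂ _≤_ (cong (2 *_) (occurrences-collapse p S)) (length-map collapse S) bound
    where
    L : List (Subset m)
    L = map collapse S
    L-unique : Unique L
    L-unique = map-unique collapse S-unique (λ x∈ y∈ → collapse-injective (K-least x∈) (K-least y∈))
    L-closed : IntersectionClosed L
    L-closed _ _ x∈L y∈L with ∈-map⁻ collapse x∈L | ∈-map⁻ collapse y∈L
    ... | A , A∈S , refl | B , B∈S , refl =
      subst (_∈ L) (collapse-∩ A B) (∈-map⁺ collapse (S-closed A B A∈S B∈S))
    0∈L : 0ᶠ ∈ L
    0∈L = subst (_∈ L) collapse-K (∈-map⁺ collapse K∈S)

⋂-member : ∀ {m} {S : List (Subset m)} → IntersectionClosed S →
           ∀ {c cs} → c ∈ S → All (_∈ S) cs → ⋂ (c ∷ cs) ∈ S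
⋂-member {S = S} S-closed {c} c∈S [] = subst (_∈ S) (sym (∩-identityʳ c)) c∈S
⋂-member S-closed {c} c∈S (d∈S ∷ ds∈S) = S-closed c _ c∈S (⋂-member S-closed d∈S ds∈S)

⋂-lower : ∀ {m} {A : Subset m} {cs} → A ∈ cs → ⋂ cs ⊆ₛ A
⋂-lower {cs = c ∷ cs} (here refl)  = p∩q⊆p c (⋂ cs)
⋂-lower {cs = c ∷ cs} (there A∈cs) = ⊆-trans (p∩q⊆q c (⋂ cs)) (⋂-lower A∈cs)

-- The least member K = ⋂ S of a family with two distinct members misses
-- some coordinate q, so S can be collapsed.
II⇒I : StatementII → StatementI
II⇒I statementII m [] _ _ ()
II⇒I statementII m (_ ∷ []) _ _ (s≤s ())
II⇒I statementII m S@(a ∷ b ∷ rest) S-unique@((a≢b ∷ _) ∷ _) S-closed _ =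
  let (q , q∉K) = ¬∀⟶∃¬ m (_∈ₛ K) (_∈? K) K≢1
  in Collapse.II⇒I-collapsed K q q∉K statementII S S-unique S-closed K∈S ⋂-lower
  where
  K : Subset m
  K = ⋂ S
  K∈S : K ∈ S
  K∈S = ⋂-member S-closed (here refl) (All.tabulate there)
  K≢1 : ¬ (∀ i → i ∈ₛ K)
  K≢1 all∈K = a≢b (⊆-antisym (λ {i} _ → ⋂-lower {cs = S} (there (here refl)) (all∈K i))
                             (λ {i} _ → ⋂-lower {cs = S} (here refl) (all∈K i)))

proposition3 : StatementI ⇔ StatementII
proposition3 = mk⇔ I⇒II II⇒I
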